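{- For every $u\in\mathbb{YF}$, the singleton $\{u\}$ is first-order definable in $\mathbf{YF}^*=\langle\mathbb{YF},\geqslant,2\rangle$. Consequently, the map $a$ is the unique nontrivial automorphism of the Young–Fibonacci graph $(\mathbb{YF},\geqslant)$.
   Context: $\mathbb{YF}$ is the set of all finite words (including the empty word $\varepsilon$) over $\{1,2\}$. For a word $v$, $\#v$ is its length and $d(v)$ the number of letters $2$. Order: write $x=x'w$, $y=y'w$ with $w$ the longest common suffix; then $y\geqslant x$ iff $d(y')\geqslant\#x'$. $\mathbf{YF}^*$ is this partial order with an added constant symbol interpreted as the word $2$. A relation $R\subseteq\mathbb{YF}^k$ is first-order definable in a structure if there is a first-order formula $\phi(x_1,\dots,x_k)$ in the language of the structure (no extra parameters) whose set of satisfying tuples is exactly $R$. The map $a:\mathbb{YF}\to\mathbb{YF}$ is defined by $a(v11)=v2$, $a(v2)=v11$, $a(v21)=v21$ for all $v\in\mathbb{YF}$, and $a(1)=1$, $a(\varepsilon)=\varepsilon$; it is an automorphism of $(\mathbb{YF},\geqslant)$. -}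

module Defs where

open import Data.Nat using (ℕ; zero; suc; _+_; _≤_)
open import Data.Fin using (Fin; zero; suc)
open import Data.Product using (Σ; _×_; _,_)
open import Data.Empty using (⊥)
open import Relation.Binary.PropositionalEquality using (_≡_)
open import Function.Bundles using (_⇔_)
open import Function.Definitions using (Bijective)

data Letter : Set where
  one two : Letter

-- Words are built by appending letters on the RIGHT:
-- (v · l) is the word v followed by the letter l.
infixl 6 _·_
data Word : Set where
  ε   : Word
  _·_ : Word → Letter → Word

len : Word → ℕ
len ε       = 0
len (v · _) = suc (len v)

d : Word → ℕ
d ε         = 0
d (v · one) = d v
d (v · two) = suc (d v)

stripSuffix : Word → Word → Word × Word
stripSuffix (x · one) (y · one) = stripSuffix x y
stripSuffix (x · two) (y · two) = stripSuffix x y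
stripSuffix x y = x , y

-- The Young–Fibonacci order:  y ⊒ x  means  y ≥ x,  i.e. d(y') ≥ #x'.
infix 4 _⊒_
_⊒_ : Word → Word → Set
y ⊒ x with stripSuffix x y
... | x' , y' = len x' ≤ d y'

data Term (n : ℕ) : Set where
  var  : Fin n → Term n
  cTwo : Term n

data Formula : ℕ → Set where
  _≥'_ : ∀ {n} → Term n → Term n → Formula n
  _≐_  : ∀ {n} → Term n → Term n → Formula n
  ¬'_  : ∀ {n} → Formula n → Formula n
  _∧'_ : ∀ {n} → Formula n → Formula n → Formula n
  ∃'_  : ∀ {n} → Formula (suc n) → Formula n

Env : ℕ → Set
Env n = Fin n → Word

extend : ∀ {n} → Word → Env n → Env (suc n)
extend w ρ zero    = w
extend w ρ (suc i) = ρ i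

evalTerm : ∀ {n} → Env n → Term n → Word
evalTerm ρ (var i) = ρ i
evalTerm ρ cTwo    = ε · two

⟦_⟧ : ∀ {n} → Formula n → Env n → Set
⟦ s ≥' t ⟧ ρ = evalTerm ρ s ⊒ evalTerm ρ t
⟦ s ≐ t  ⟧ ρ = evalTerm ρ s ≡ evalTerm ρ t
⟦ ¬' φ   ⟧ ρ = ⟦ φ ⟧ ρ → ⊥
⟦ φ ∧' ψ ⟧ ρ = ⟦ φ ⟧ ρ × ⟦ ψ ⟧ ρ
⟦ ∃' φ   ⟧ ρ = Σ Word λ w → ⟦ φ ⟧ (extend w ρ)

Definable : (k : ℕ) → (Env k → Set) → Set
Definable k R = Σ (Formula k) λ φ → ∀ (ρ : Env k) → (⟦ φ ⟧ ρ ⇔ R ρ)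

Singleton : Word → Env 1 → Set
Singleton u ρ = ρ zero ≡ u

IsAutomorphism : (Word → Word) → Set
IsAutomorphism f = Bijective _≡_ _≡_ f × (∀ x y → (y ⊒ x ⇔ f y ⊒ f x))

a : Word → Word
a ε                 = ε
a (ε · one)         = ε · one
a (v · one · one)   = v · two
a (v · two · one)   = v · two · one
a (v · two)         = v · one · one

-- Every word is pinned down by a formula following its letters from the left: ε is the
-- least element, 1w is the element whose only lower cover is w, and 2u is the cover of 1u
-- other than 11u.  The one ambiguity is that 2 and 11 both have 1 as their only lower cover,
-- and the constant 2 resolves it.  Hence an automorphism fixing 2 fixes everything, while
-- the constant-free part of the argument shows that any automorphism sends 2 to 2 or to 11;
-- in the second case composing with a brings us back to the first.
module Submission where

open import Defs
open import Data.Nat using (ℕ; suc; _+_; _≤_; _<_; z≤n; s≤s)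
open import Data.Nat.Properties
  using (1+n≢n; ≤-pred; ≤-trans; +-mono-≤; +-suc; m≤n⇒m≤1+n; <-irrefl; <-≤-trans)
open import Data.Fin using (Fin; zero; suc)
open import Data.List using (List; []; _∷_; _∷ʳ_)
open import Data.Unit using (⊤)
open import Data.Product using (∃-syntax; _×_; _,_; proj₁; proj₂; map₂; uncurry)
open import Data.Product.Function.NonDependent.Propositional using (_×-⇔_)
open import Data.Product.Function.Dependent.Propositional using (Σ-⇔)
open import Data.Sum using (_⊎_; inj₁; inj₂)
open import Data.Empty using (⊥-elim)
open import Function using (_∘_)
open import Function.Bundles using (_⇔_; mk⇔; Equivalence; mk↠)
open import Function.Consequences.Propositional
  using (inverseᵇ⇒bijective; strictlyInverseˡ⇒inverseˡ; strictlyInverseʳ⇒inverseʳ)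
import Function.Construct.Composition as Compose
import Function.Properties.Equivalence as ⇔
open import Function.Related.TypeIsomorphisms using (¬-cong-⇔)
open import Relation.Nullary using (¬_; Stable; yes; no)
open import Relation.Nullary.Decidable using (decidable-stable)
open import Relation.Binary.Definitions using (DecidableEquality)
open import Relation.Binary.PropositionalEquality
open ≡-Reasoning

open Equivalence using (to; from)

_≟ᴸ_ : DecidableEquality Letter
one ≟ᴸ one = yes refl
one ≟ᴸ two = no λ ()
two ≟ᴸ one = no λ ()
two ≟ᴸ two = yes refl

·-injective : ∀ {v w l m} → v · l ≡ w · m → v ≡ w × l ≡ m
·-injective refl = refl , refl

_≟_ : DecidableEquality Word
ε       ≟ ε       = yes refl
ε       ≟ (w · m) = no λ ()
(v · l) ≟ ε       = no λ ()
(v · l) ≟ (w · m) with v ≟ w | l ≟ᴸ m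
... | yes refl | yes refl = yes refl
... | no v≢w   | _        = no (v≢w ∘ proj₁ ∘ ·-injective)
... | _        | no l≢m   = no (l≢m ∘ proj₂ ∘ ·-injective)

≡-stable : ∀ {v w : Word} → Stable (v ≡ w)
≡-stable {v} {w} = decidable-stable (v ≟ w)

infixr 5 _◂_
_◂_ : Letter → Word → Word
l ◂ ε     = ε · l
l ◂ v · m = (l ◂ v) · m

len-◂ : ∀ l t → len (l ◂ t) ≡ suc (len t)
len-◂ l ε       = refl
len-◂ l (t · m) = cong suc (len-◂ l t)

d-one◂ : ∀ t → d (one ◂ t) ≡ d t
d-one◂ ε         = refl
d-one◂ (t · one) = d-one◂ t
d-one◂ (t · two) = cong suc (d-one◂ t)

d-two◂ : ∀ t → d (two ◂ t) ≡ suc (d t)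
d-two◂ ε         = refl
d-two◂ (t · one) = d-two◂ t
d-two◂ (t · two) = cong suc (d-two◂ t)

◂≢ε : ∀ l t → l ◂ t ≢ ε
◂≢ε l ε       ()
◂≢ε l (t · m) ()

◂≢ : ∀ l t → l ◂ t ≢ t
◂≢ l t e = 1+n≢n (trans (sym (len-◂ l t)) (cong len e))

◂-injective : ∀ {l m} t s → l ◂ t ≡ m ◂ s → l ≡ m × t ≡ s
◂-injective ε       ε       refl = refl , refl
◂-injective ε       (s · _) e    = ⊥-elim (◂≢ε _ s (sym (proj₁ (·-injective e))))
◂-injective (t · _) ε       e    = ⊥-elim (◂≢ε _ t (proj₁ (·-injective e)))
◂-injective (t · _) (s · _) e    with ·-injective e
... | e′ , refl with ◂-injective t s e′
...   | l≡m , refl = l≡m , refl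

two◂≢one◂ : ∀ t s → two ◂ t ≢ one ◂ s
two◂≢one◂ t s e with ◂-injective t s e
... | () , _

data LeftView : Word → Set where
  empty : LeftView ε
  cons  : ∀ l t → LeftView (l ◂ t)

leftView : ∀ x → LeftView x
leftView ε = empty
leftView (x · m) with leftView x
... | empty    = cons m ε
... | cons l t = cons l (t · m)

fromList : List Letter → Word
fromList []      = ε
fromList (l ∷ w) = l ◂ fromList w

toList : Word → List Letter
toList ε       = []
toList (v · l) = toList v ∷ʳ l

fromList-∷ʳ : ∀ w l → fromList (w ∷ʳ l) ≡ fromList w · l
fromList-∷ʳ []      l = refl
fromList-∷ʳ (m ∷ w) l = cong (m ◂_) (fromList-∷ʳ w l)

fromList-toList : ∀ u → fromList (toList u) ≡ u
fromList-toList ε       = refl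
fromList-toList (v · l) = trans (fromList-∷ʳ (toList v) l) (cong (_· l) (fromList-toList v))

ε-least : ∀ y → y ⊒ ε
ε-least ε       = z≤n
ε-least (y · l) = z≤n

ε⊒⇒≡ε : ∀ x → ε ⊒ x → x ≡ ε
ε⊒⇒≡ε ε         _ = refl
ε⊒⇒≡ε (x · one) ()
ε⊒⇒≡ε (x · two) ()

⊒-refl : ∀ x → x ⊒ x
⊒-refl ε         = z≤n
⊒-refl (x · one) = ⊒-refl x
⊒-refl (x · two) = ⊒-refl x

-- The sum of the letters of w: the level of w in the graded poset YF.
rank : Word → ℕ
rank w = len w + d w

d≤len : ∀ w → d w ≤ len w
d≤len ε         = z≤n
d≤len (w · one) = m≤n⇒m≤1+n (d≤len w)
d≤len (w · two) = s≤s (d≤len w)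

rank-·two : ∀ w → rank (w · two) ≡ suc (suc (rank w))
rank-·two w = cong suc (+-suc (len w) (d w))

rank-one◂ : ∀ t → rank (one ◂ t) ≡ suc (rank t)
rank-one◂ t = cong₂ _+_ (len-◂ one t) (d-one◂ t)

rank-two◂ : ∀ t → rank (two ◂ t) ≡ suc (suc (rank t))
rank-two◂ t = trans (cong₂ _+_ (len-◂ two t) (d-two◂ t)) (cong suc (+-suc (len t) (d t)))

rank-two◂-one◂ : ∀ t → rank (two ◂ t) ≡ suc (rank (one ◂ t))
rank-two◂-one◂ t = trans (rank-two◂ t) (cong suc (sym (rank-one◂ t)))

rank-mono : ∀ x y → len x ≤ d y → rank x ≤ rank y
rank-mono x y h = +-mono-≤ (≤-trans h (d≤len y)) (≤-trans (d≤len x) h)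

⊒⇒≡⊎rank< : ∀ y x → y ⊒ x → x ≡ y ⊎ rank x < rank y
⊒⇒≡⊎rank< ε       ε         _ = inj₁ refl
⊒⇒≡⊎rank< (y · l) ε         _ = inj₂ (s≤s z≤n)
⊒⇒≡⊎rank< ε       (x · one) ()
⊒⇒≡⊎rank< ε       (x · two) ()
⊒⇒≡⊎rank< (y · one) (x · one) h with ⊒⇒≡⊎rank< y x h
... | inj₁ refl = inj₁ refl
... | inj₂ x<y  = inj₂ (s≤s x<y)
⊒⇒≡⊎rank< (y · two) (x · two) h with ⊒⇒≡⊎rank< y x h
... | inj₁ refl = inj₁ refl
... | inj₂ x<y  rewrite rank-·two y | rank-·two x = inj₂ (s≤s (s≤s x<y))
⊒⇒≡⊎rank< (y · two) (x · one) h rewrite rank-·two y = inj₂ (s≤s (s≤s (rank-mono x y (≤-pred h))))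
⊒⇒≡⊎rank< (y · one) (x · two) h = inj₂ (s≤s (rank-mono (x · two) y h))

◂-⊒ : ∀ l t → l ◂ t ⊒ t
◂-⊒ l ε         = z≤n
◂-⊒ l (t · one) = ◂-⊒ l t
◂-⊒ l (t · two) = ◂-⊒ l t

two◂⊒one◂ : ∀ t → two ◂ t ⊒ one ◂ t
two◂⊒one◂ ε         = s≤s z≤n
two◂⊒one◂ (t · one) = two◂⊒one◂ t
two◂⊒one◂ (t · two) = two◂⊒one◂ t

two◂-mono : ∀ t s → t ⊒ s → two ◂ t ⊒ two ◂ s
two◂-mono ε         ε         _ = ⊒-refl (ε · two)
two◂-mono ε         (s · one) ()
two◂-mono ε         (s · two) ()
two◂-mono (t · one) ε         _ = subst (1 ≤_) (sym (d-two◂ t)) (s≤s z≤n)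
two◂-mono (t · two) ε         _ = ε-least (two ◂ t)
two◂-mono (t · one) (s · one) h = two◂-mono t s h
two◂-mono (t · two) (s · two) h = two◂-mono t s h
two◂-mono (t · two) (s · one) h = s≤s (subst₂ _≤_ (sym (len-◂ two s)) (sym (d-two◂ t)) h)
two◂-mono (t · one) (s · two) h = subst₂ (λ m n → suc m ≤ n) (sym (len-◂ two s)) (sym (d-two◂ t)) (s≤s h)

one◂⊒⇒≡⊎⊒ : ∀ t v → one ◂ t ⊒ v → v ≡ one ◂ t ⊎ t ⊒ v
one◂⊒⇒≡⊎⊒ ε         ε         _ = inj₂ z≤n
one◂⊒⇒≡⊎⊒ ε         (v · one) h rewrite ε⊒⇒≡ε v h = inj₁ refl
one◂⊒⇒≡⊎⊒ ε         (v · two) ()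
one◂⊒⇒≡⊎⊒ (t · m)   ε         _ = inj₂ (ε-least (t · m))
one◂⊒⇒≡⊎⊒ (t · one) (v · one) h with one◂⊒⇒≡⊎⊒ t v h
... | inj₁ refl = inj₁ refl
... | inj₂ t⊒v  = inj₂ t⊒v
one◂⊒⇒≡⊎⊒ (t · two) (v · two) h with one◂⊒⇒≡⊎⊒ t v h
... | inj₁ refl = inj₁ refl
... | inj₂ t⊒v  = inj₂ t⊒v
one◂⊒⇒≡⊎⊒ (t · one) (v · two) h = inj₂ (subst (suc (len v) ≤_) (d-one◂ t) h)
one◂⊒⇒≡⊎⊒ (t · two) (v · one) h = inj₂ (subst (suc (len v) ≤_) (cong suc (d-one◂ t)) h)

two◂⊒one◂⇒⊒ : ∀ t u → two ◂ t ⊒ one ◂ u → t ⊒ u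
two◂⊒one◂⇒⊒ ε         ε                 _       = z≤n
two◂⊒one◂⇒⊒ ε         (ε · one)         (s≤s ())
two◂⊒one◂⇒⊒ ε         ((u · _) · one)   (s≤s ())
two◂⊒one◂⇒⊒ ε         (ε · two)         ()
two◂⊒one◂⇒⊒ ε         ((u · one) · two) ()
two◂⊒one◂⇒⊒ ε         ((u · two) · two) ()
two◂⊒one◂⇒⊒ (t · m)   ε                 _       = ε-least (t · m)
two◂⊒one◂⇒⊒ (t · one) (u · one)         h       = two◂⊒one◂⇒⊒ t u h
two◂⊒one◂⇒⊒ (t · two) (u · two)         h       = two◂⊒one◂⇒⊒ t u h
two◂⊒one◂⇒⊒ (t · one) (u · two)         h       =
  ≤-pred (subst₂ (λ m n → suc m ≤ n) (len-◂ one u) (d-two◂ t) h)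
two◂⊒one◂⇒⊒ (t · two) (u · one)         h       =
  subst₂ _≤_ (len-◂ one u) (d-two◂ t) (≤-pred h)

two⊒⇒≡⊎one⊒ : ∀ z → ε · two ⊒ z → z ≡ ε · two ⊎ ε · one ⊒ z
two⊒⇒≡⊎one⊒ ε               _ = inj₂ z≤n
two⊒⇒≡⊎one⊒ (z · two)       h rewrite ε⊒⇒≡ε z h = inj₁ refl
two⊒⇒≡⊎one⊒ (ε · one)       _ = inj₂ z≤n
two⊒⇒≡⊎one⊒ ((z · _) · one) (s≤s ())

infix 4 _⊐_ _⋗_ _⋗!_

_⊐_ : Word → Word → Set
y ⊐ x = y ⊒ x × y ≢ x

_⋗_ : Word → Word → Set
y ⋗ x = y ⊐ x × ¬ (∃[ z ] y ⊐ z × z ⊐ x)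

_⋗!_ : Word → Word → Set
y ⋗! x = y ⋗ x × ¬ (∃[ z ] y ⋗ z × z ≢ x)

⋗-byRank : ∀ {y x} → y ⊒ x → rank y ≡ suc (rank x) → y ⋗ x
⋗-byRank {y} {x} y⊒x rank≡ = (y⊒x , y≢x) , nothing-between
  where
  y≢x : y ≢ x
  y≢x refl = 1+n≢n (sym rank≡)
  nothing-between : ¬ (∃[ z ] y ⊐ z × z ⊐ x)
  nothing-between (z , (y⊒z , y≢z) , (z⊒x , z≢x)) with ⊒⇒≡⊎rank< y z y⊒z | ⊒⇒≡⊎rank< z x z⊒x
  ... | inj₁ z≡y | _        = y≢z (sym z≡y)
  ... | _        | inj₁ x≡z = z≢x (sym x≡z)
  ... | inj₂ z<y | inj₂ x<z = <-irrefl refl (<-≤-trans x<z (≤-pred (subst (rank z <_) rank≡ z<y)))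

⋗-between : ∀ {x y z} → x ⋗ y → x ⊒ z → z ⊒ y → x ≢ z → z ≡ y
⋗-between {z = z} (_ , nothing-between) x⊒z z⊒y x≢z =
  ≡-stable λ z≢y → nothing-between (z , (x⊒z , x≢z) , (z⊒y , z≢y))

⋗!-intro : ∀ {x w} → x ⋗ w → (∀ z → x ⊒ z → z ≡ x ⊎ w ⊒ z) → x ⋗! w
⋗!-intro {x} {w} x⋗w@((x⊒w , x≢w) , _) below = x⋗w , no-other
  where
  no-other : ¬ (∃[ z ] x ⋗ z × z ≢ w)
  no-other (z , x⋗z@((x⊒z , x≢z) , _) , z≢w) with below z x⊒z
  ... | inj₁ refl = x≢z refl
  ... | inj₂ w⊒z  = z≢w (sym (⋗-between x⋗z x⊒w w⊒z x≢w))

one◂⋗! : ∀ w → one ◂ w ⋗! w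
one◂⋗! w = ⋗!-intro (⋗-byRank (◂-⊒ one w) (rank-one◂ w)) (one◂⊒⇒≡⊎⊒ w)

two⋗!one : ε · two ⋗! ε · one
two⋗!one = ⋗!-intro (⋗-byRank (s≤s z≤n) refl) two⊒⇒≡⊎one⊒

two◂⋗one◂ : ∀ u → two ◂ u ⋗ one ◂ u
two◂⋗one◂ u = ⋗-byRank (two◂⊒one◂ u) (rank-two◂-one◂ u)

rank-predecessor : ∀ t → t ≢ ε → ∃[ s ] t ⊒ s × rank t ≡ suc (rank s)
rank-predecessor t t≢ε with leftView t
... | empty      = ⊥-elim (t≢ε refl)
... | cons one s = s , ◂-⊒ one s , rank-one◂ s
... | cons two s = one ◂ s , two◂⊒one◂ s , rank-two◂-one◂ s

one◂⋗⇒≡ : ∀ t w → one ◂ t ⋗ w → t ≡ w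
one◂⋗⇒≡ t w x⋗w@((x⊒w , x≢w) , _) with one◂⊒⇒≡⊎⊒ t w x⊒w
... | inj₁ w≡x = ⊥-elim (x≢w (sym w≡x))
... | inj₂ t⊒w = ⋗-between x⋗w (◂-⊒ one t) t⊒w (◂≢ one t)

-- 2t also covers 2s for every lower cover s of t, so its unique lower cover 1t forces t = ε.
two◂⋗!⇒ : ∀ t w → two ◂ t ⋗! w → w ≡ ε · one × t ≡ ε
two◂⋗!⇒ t w (_ , unique) = trans (sym one◂t≡w) (cong (one ◂_) t≡ε) , t≡ε
  where
  one◂t≡w : one ◂ t ≡ w
  one◂t≡w = ≡-stable λ one◂t≢w → unique (one ◂ t , two◂⋗one◂ t , one◂t≢w)
  t≡ε : t ≡ ε
  t≡ε = ≡-stable λ t≢ε →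
    let (s , t⊒s , rank≡) = rank-predecessor t t≢ε
        rank-two◂≡ = begin
          rank (two ◂ t)            ≡⟨ rank-two◂ t ⟩
          suc (suc (rank t))        ≡⟨ cong (2 +_) rank≡ ⟩
          suc (suc (suc (rank s)))  ≡⟨ cong suc (rank-two◂ s) ⟨
          suc (rank (two ◂ s))      ∎
    in unique (two ◂ s , ⋗-byRank (two◂-mono t s t⊒s) rank-two◂≡ ,
               λ two◂s≡w → two◂≢one◂ s t (trans two◂s≡w (sym one◂t≡w)))

⋗!-inversion : ∀ {x w} → x ⋗! w → x ≡ one ◂ w ⊎ (w ≡ ε · one × x ≡ ε · two)
⋗!-inversion {x} {w} x⋗!w@(x⋗w@((x⊒w , x≢w) , _) , _) with leftView x
... | empty      = ⊥-elim (x≢w (sym (ε⊒⇒≡ε w x⊒w)))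
... | cons one t = inj₁ (cong (one ◂_) (one◂⋗⇒≡ t w x⋗w))
... | cons two t = inj₂ (map₂ (cong (two ◂_)) (two◂⋗!⇒ t w x⋗!w))

⋗!⇔≡one◂ : ∀ x {w} → w ≢ ε · one → x ⋗! w ⇔ x ≡ one ◂ w
⋗!⇔≡one◂ x {w} w≢one = mk⇔ unique-cover λ { refl → one◂⋗! w }
  where
  unique-cover : x ⋗! w → x ≡ one ◂ w
  unique-cover x⋗!w with ⋗!-inversion x⋗!w
  ... | inj₁ x≡one◂w    = x≡one◂w
  ... | inj₂ (w≡one , _) = ⊥-elim (w≢one w≡one)

⋗!-≢two⇔≡one◂ : ∀ x w → (x ⋗! w × x ≢ ε · two) ⇔ x ≡ one ◂ w
⋗!-≢two⇔≡one◂ x w = mk⇔ (uncurry unique-cover) λ { refl → one◂⋗! w , two◂≢one◂ ε w ∘ sym }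
  where
  unique-cover : x ⋗! w → x ≢ ε · two → x ≡ one ◂ w
  unique-cover x⋗!w x≢two with ⋗!-inversion x⋗!w
  ... | inj₁ x≡one◂w  = x≡one◂w
  ... | inj₂ (_ , x≡two) = ⊥-elim (x≢two x≡two)

⋗one◂⇒≡two◂ : ∀ {x u} → x ⋗ one ◂ u → x ≢ one ◂ one ◂ u → x ≡ two ◂ u
⋗one◂⇒≡two◂ {x} {u} x⋗one◂u@((x⊒ , _) , nothing-between) x≢one◂one◂u with leftView x
... | empty      = ⊥-elim (◂≢ε one u (ε⊒⇒≡ε _ x⊒))
... | cons one t = ⊥-elim (x≢one◂one◂u (cong (one ◂_) (one◂⋗⇒≡ t (one ◂ u) x⋗one◂u)))
... | cons two t = cong (two ◂_) (≡-stable λ t≢u → nothing-between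
  (two ◂ u , (two◂-mono t u (two◂⊒one◂⇒⊒ t u x⊒) , t≢u ∘ proj₂ ∘ ◂-injective t u) ,
             (two◂⊒one◂ u , two◂≢one◂ u u)))

⋗-≢⇔≡two◂ : ∀ x u → (x ⋗ one ◂ u × x ≢ one ◂ one ◂ u) ⇔ x ≡ two ◂ u
⋗-≢⇔≡two◂ x u = mk⇔ (uncurry ⋗one◂⇒≡two◂) λ { refl → two◂⋗one◂ u , two◂≢one◂ u (one ◂ u) }

a-·two : ∀ w → a (w · two) ≡ w · one · one
a-·two ε         = refl
a-·two (w · one) = refl
a-·two (w · two) = refl

a-involutive : ∀ x → a (a x) ≡ x
a-involutive ε                 = refl
a-involutive (ε · one)         = refl
a-involutive (v · one · one)   rewrite a-·two v = refl
a-involutive (v · two · one)   = refl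
a-involutive (v · two)         rewrite a-·two v = refl

a-mono : ∀ x y → y ⊒ x → a y ⊒ a x
a-mono ε               y               _ = ε-least (a y)
a-mono (ε · one)       ε               ()
a-mono (ε · one)       (ε · one)       h = h
a-mono (ε · one)       (w · one · one) _ = s≤s z≤n
a-mono (ε · one)       (w · two · one) h = h
a-mono (ε · one)       (w · two)       _ rewrite a-·two w = ε-least (w · one)
a-mono (v · one · one) ε               ()
a-mono (v · one · one) (ε · one)       ()
a-mono (v · one · one) (w · one · one) h = h
a-mono (v · one · one) (w · two · one) h = h
a-mono (v · one · one) (w · two)       h rewrite a-·two w = ≤-pred h
a-mono (v · two · one) ε               ()
a-mono (v · two · one) (ε · one)       ()
a-mono (v · two · one) (w · one · one) h = s≤s h
a-mono (v · two · one) (w · two · one) h = h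
a-mono (v · two · one) (w · two)       h rewrite a-·two w = ≤-pred h
a-mono (v · two)       ε               ()
a-mono (v · two)       (ε · one)       ()
a-mono (v · two)       (w · one · one) h rewrite a-·two v = s≤s h
a-mono (v · two)       (w · two · one) h rewrite a-·two v = h
a-mono (v · two)       (w · two)       h rewrite a-·two w | a-·two v = h

a-isAutomorphism : IsAutomorphism a
a-isAutomorphism = bijective , λ x y → mk⇔ (a-mono x y) (reflects x y)
  where
  bijective = inverseᵇ⇒bijective
    (strictlyInverseˡ⇒inverseˡ a a-involutive , strictlyInverseʳ⇒inverseʳ a a-involutive)
  reflects : ∀ x y → a y ⊒ a x → y ⊒ x
  reflects x y h = subst₂ _⊒_ (a-involutive y) (a-involutive x) (a-mono (a x) (a y) h)

∘-isAutomorphism : ∀ {f g} → IsAutomorphism f → IsAutomorphism g → IsAutomorphism (g ∘ f)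
∘-isAutomorphism {f} (f-bij , f-iso) (g-bij , g-iso) =
  Compose.bijective _≡_ _≡_ _≡_ f-bij g-bij , λ x y → ⇔.trans (f-iso x y) (g-iso (f x) (f y))

-- A formula in one distinguished free variable that makes sense in every context;
-- this spares us weakening formulas under the quantifiers that use them.
Unary : Set
Unary = ∀ {n} → Fin n → Formula n

record Defines (P : Unary) (w : Word) : Set where
  constructor mkDefines
  field defines : ∀ {n} (i : Fin n) (ρ : Env n) → ⟦ P i ⟧ ρ ⇔ ρ i ≡ w

open Defines

Defines⇒Definable : ∀ {P : Unary} {u} → Defines P u → Definable 1 (Singleton u)
Defines⇒Definable {P} D = P zero , defines D zero

∃-one-point : ∀ {P : Unary} {w n} (φ : Formula (suc n)) → Defines P w → (ρ : Env n) →
              ⟦ ∃' (P zero ∧' φ) ⟧ ρ ⇔ ⟦ φ ⟧ (extend w ρ)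
∃-one-point φ D ρ = mk⇔
  (λ { (y , Py , φy) → subst (λ y → ⟦ φ ⟧ (extend y ρ)) (to (defines D zero (extend y ρ)) Py) φy })
  (λ φw → _ , from (defines D zero (extend _ ρ)) refl , φw)

infix 25 _≢'_ _>'_

_≢'_ : ∀ {n} → Term n → Term n → Formula n
s ≢' t = ¬' (s ≐ t)

_>'_ : ∀ {n} → Term n → Term n → Formula n
s >' t = (s ≥' t) ∧' (s ≢' t)

covers' : ∀ {n} → Fin n → Fin n → Formula n
covers' i j = (var i >' var j) ∧' (¬' (∃' ((var (suc i) >' var zero) ∧' (var zero >' var (suc j)))))

coversExactly' : ∀ {n} → Fin n → Fin n → Formula n
coversExactly' i j = covers' i j ∧' (¬' (∃' (covers' (suc i) zero ∧' (var zero ≢' var (suc j)))))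

isLeast : Unary
isLeast i = ¬' (∃' (var (suc i) >' var zero))

uniqueCoverOf : Unary → Unary
uniqueCoverOf P i = ∃' (P zero ∧' coversExactly' (suc i) zero)

-- 2 and 11 both have 1 as their only lower cover; only the constant tells them apart.
prependOne : Unary → Unary
prependOne P i = uniqueCoverOf P i ∧' (var i ≢' cTwo)

prependTwo : Unary → Unary
prependTwo P i = (∃' (prependOne P zero ∧' covers' (suc i) zero)) ∧' (¬' (prependOne (prependOne P) i))

minimal⇔≡ε : ∀ x → (¬ (∃[ z ] x ⊐ z)) ⇔ x ≡ ε
minimal⇔≡ε x = mk⇔ (minimal⇒≡ε x) λ { refl (z , ε⊒z , ε≢z) → ε≢z (sym (ε⊒⇒≡ε z ε⊒z)) }
  where
  minimal⇒≡ε : ∀ x → ¬ (∃[ z ] x ⊐ z) → x ≡ ε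
  minimal⇒≡ε ε       _       = refl
  minimal⇒≡ε (v · l) minimal = ⊥-elim (minimal (ε , ε-least (v · l) , λ ()))

isLeast-defines : Defines isLeast ε
isLeast-defines = mkDefines λ i ρ → minimal⇔≡ε (ρ i)

uniqueCoverOf-defines : ∀ {P : Unary} {w} → Defines P w → w ≢ ε · one → Defines (uniqueCoverOf P) (one ◂ w)
uniqueCoverOf-defines D w≢one = mkDefines λ i ρ →
  ⇔.trans (∃-one-point (coversExactly' (suc i) zero) D ρ) (⋗!⇔≡one◂ (ρ i) w≢one)

prependOne-defines : ∀ {P : Unary} {w} → Defines P w → Defines (prependOne P) (one ◂ w)
prependOne-defines {w = w} D = mkDefines λ i ρ →
  ⇔.trans (∃-one-point (coversExactly' (suc i) zero) D ρ ×-⇔ ⇔.refl) (⋗!-≢two⇔≡one◂ (ρ i) w)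

prependTwo-defines : ∀ {P : Unary} {u} → Defines P u → Defines (prependTwo P) (two ◂ u)
prependTwo-defines {u = u} D = mkDefines λ i ρ →
  ⇔.trans (∃-one-point (covers' (suc i) zero) D₁ ρ ×-⇔ ¬-cong-⇔ (defines (prependOne-defines D₁) i ρ))
          (⋗-≢⇔≡two◂ (ρ i) u)
  where D₁ = prependOne-defines D

definingFormula : List Letter → Unary
definingFormula []        = isLeast
definingFormula (one ∷ w) = prependOne (definingFormula w)
definingFormula (two ∷ w) = prependTwo (definingFormula w)

definingFormula-defines : ∀ w → Defines (definingFormula w) (fromList w)
definingFormula-defines []        = isLeast-defines
definingFormula-defines (one ∷ w) = prependOne-defines (definingFormula-defines w)
definingFormula-defines (two ∷ w) = prependTwo-defines (definingFormula-defines w)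

word-defined : ∀ u → Defines (definingFormula (toList u)) u
word-defined u = subst (Defines (definingFormula (toList u))) (fromList-toList u)
                       (definingFormula-defines (toList u))

singleton-definable : ∀ u → Definable 1 (Singleton u)
singleton-definable u = Defines⇒Definable (word-defined u)

uniqueCoverOfOne : Formula 1
uniqueCoverOfOne = uniqueCoverOf (uniqueCoverOf isLeast) zero

uniqueCoverOfOne-sem : ∀ x → ⟦ uniqueCoverOfOne ⟧ (λ _ → x) ⇔ x ⋗! ε · one
uniqueCoverOfOne-sem x =
  ∃-one-point {n = 1} (coversExactly' (suc zero) zero)
              (uniqueCoverOf-defines {w = ε} isLeast-defines λ ()) (λ _ → x)

FixesTerm : ∀ {n} → (Word → Word) → Term n → Set
FixesTerm f (var _) = ⊤
FixesTerm f cTwo    = f (ε · two) ≡ ε · two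

FixesConstants : ∀ {n} → (Word → Word) → Formula n → Set
FixesConstants f (s ≥' t) = FixesTerm f s × FixesTerm f t
FixesConstants f (s ≐ t)  = FixesTerm f s × FixesTerm f t
FixesConstants f (¬' φ)   = FixesConstants f φ
FixesConstants f (φ ∧' ψ) = FixesConstants f φ × FixesConstants f ψ
FixesConstants f (∃' φ)   = FixesConstants f φ

fixesTwo⇒FixesConstants : ∀ {f n} → f (ε · two) ≡ ε · two → (φ : Formula n) → FixesConstants f φ
fixesTwo⇒FixesConstants {f} f2 = go
  where
  term : ∀ {n} (t : Term n) → FixesTerm f t
  term (var _) = _
  term cTwo    = f2
  go : ∀ {n} (φ : Formula n) → FixesConstants f φ
  go (s ≥' t) = term s , term t
  go (s ≐ t)  = term s , term t
  go (¬' φ)   = go φ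
  go (φ ∧' ψ) = go φ , go ψ
  go (∃' φ)   = go φ

evalTerm-image : ∀ {f n} (t : Term n) → FixesTerm f t → {ρ σ : Env n} →
                 (∀ i → σ i ≡ f (ρ i)) → evalTerm σ t ≡ f (evalTerm ρ t)
evalTerm-image (var i) _  σ≡fρ = σ≡fρ i
evalTerm-image cTwo    f2 _    = sym f2

module _ {f : Word → Word} (f-auto : IsAutomorphism f) where

  private
    f-injective = proj₁ (proj₁ f-auto)
    f-surjective = proj₂ (proj₁ f-auto)
    f-iso = proj₂ f-auto

  satisfaction-invariant : ∀ {n} (φ : Formula n) → FixesConstants f φ → {ρ σ : Env n} →
                           (∀ i → σ i ≡ f (ρ i)) → ⟦ φ ⟧ ρ ⇔ ⟦ φ ⟧ σ
  satisfaction-invariant (s ≥' t) (fs , ft) {ρ} σ≡fρ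
    rewrite evalTerm-image s fs σ≡fρ | evalTerm-image t ft σ≡fρ = f-iso (evalTerm ρ t) (evalTerm ρ s)
  satisfaction-invariant (s ≐ t) (fs , ft) σ≡fρ
    rewrite evalTerm-image s fs σ≡fρ | evalTerm-image t ft σ≡fρ = mk⇔ (cong f) f-injective
  satisfaction-invariant (¬' φ) fφ σ≡fρ = ¬-cong-⇔ (satisfaction-invariant φ fφ σ≡fρ)
  satisfaction-invariant (φ ∧' ψ) (fφ , fψ) σ≡fρ =
    satisfaction-invariant φ fφ σ≡fρ ×-⇔ satisfaction-invariant ψ fψ σ≡fρ
  satisfaction-invariant (∃' φ) fφ σ≡fρ =
    Σ-⇔ (mk↠ f-surjective) (satisfaction-invariant φ fφ (extend-image σ≡fρ))
    where
    extend-image : ∀ {n w} {ρ σ : Env n} → (∀ i → σ i ≡ f (ρ i)) →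
                   ∀ i → extend (f w) σ i ≡ f (extend w ρ i)
    extend-image _    zero    = refl
    extend-image σ≡fρ (suc i) = σ≡fρ i

  image-satisfies : ∀ (φ : Formula 1) → FixesConstants f φ → ∀ {x} →
                    ⟦ φ ⟧ (λ _ → x) → ⟦ φ ⟧ (λ _ → f x)
  image-satisfies φ fφ = to (satisfaction-invariant φ fφ λ _ → refl)

  fixesTwo⇒identity : f (ε · two) ≡ ε · two → ∀ x → f x ≡ x
  fixesTwo⇒identity f2 x = to (defines (word-defined x) zero _)
    (image-satisfies φ (fixesTwo⇒FixesConstants f2 φ) (from (defines (word-defined x) zero _) refl))
    where φ = definingFormula (toList x) zero

  image-of-two : f (ε · two) ≡ ε · one · one ⊎ f (ε · two) ≡ ε · two
  -- uniqueCoverOfOne mentions no constant, so its FixesConstants obligation is solved by eta.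
  image-of-two with ⋗!-inversion (to (uniqueCoverOfOne-sem (f (ε · two)))
                    (image-satisfies uniqueCoverOfOne _ (from (uniqueCoverOfOne-sem (ε · two)) two⋗!one)))
  ... | inj₁ f2≡11     = inj₁ f2≡11
  ... | inj₂ (_ , f2≡2) = inj₂ f2≡2

mainTheorem5 : (∀ (u : Word) → Definable 1 (Singleton u))
    × IsAutomorphism a
    × ¬ (∀ (x : Word) → a x ≡ x)
    × (∀ (f : Word → Word) → IsAutomorphism f →
    (∀ x → f x ≡ x) ⊎ (∀ x → f x ≡ a x))
mainTheorem5 = singleton-definable , a-isAutomorphism , a-nontrivial , classification
  where
  a-nontrivial : ¬ (∀ x → a x ≡ x)
  a-nontrivial a≡id with a≡id (ε · two)
  ... | ()
  classification : ∀ f → IsAutomorphism f → (∀ x → f x ≡ x) ⊎ (∀ x → f x ≡ a x)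
  classification f f-auto with image-of-two f-auto
  ... | inj₂ f2≡2  = inj₁ (fixesTwo⇒identity f-auto f2≡2)
  ... | inj₁ f2≡11 = inj₂ λ x → begin
    f x         ≡⟨ a-involutive (f x) ⟨
    a (a (f x)) ≡⟨ cong a (fixesTwo⇒identity (∘-isAutomorphism f-auto a-isAutomorphism) (cong a f2≡11) x) ⟩
    a x         ∎
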